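{- Let $\pi\in\mathfrak{B}_n$ and $1\le i,j\le n$. If $\langle i,j\rangle$ is a positive square of $P_\pi$ (i.e. $\pi_i=j$), then $d^+(i,j)=d^+(i+1,j+1)=(0,0)$ and $d^+(i,j+1)=d^+(i+1,j)=(1,1)$. If $\langle i,j\rangle$ is a negative square of $P_\pi$ (i.e. $\pi_i=-j$), then $d^-(i,j)=d^-(i+1,j+1)=(0,0)$ and $d^-(i,j+1)=d^-(i+1,j)=(1,1)$. Here $d$-types are taken with respect to $\operatorname{des}_B$ and $\operatorname{ides}_B$ (the $r$-order).
   Context: $\mathfrak{B}_n$ is the set of signed permutations $\pi=\pi_1\cdots\pi_n$ ($\pi_i\in\{\pm1,\dots,\pm n\}$, $|\pi_1|,\dots,|\pi_n|$ a permutation of $[n]$), $\pi_0=0$, inverse given by $\pi^{ -1}_{|\pi_i|}=\operatorname{sgn}(\pi_i)\,i$. The $r$-order on $\mathbb{Z}$ is $-1<_r-2<_r-3<_r\cdots<_r0<_r1<_r2<_r\cdots$; $\operatorname{des}_B(\pi)=|\{i\in\{0,\dots,n-1\}:\pi_i>_r\pi_{i+1}\}|$, $\operatorname{ides}_B(\pi)=\operatorname{des}_B(\pi^{ -1})$. The grid $P_\pi$ is an $n\times n$ array of squares (rows from top, columns from left); $\langle i,j\rangle$ is the square in row $i$, column $j$; $\langle i,|\pi_i|\rangle$ is a positive square if $\pi_i>0$, negative if $\pi_i<0$. Grid point $(i,j)$ ($1\le i,j\le n+1$) is the intersection of the $i$-th horizontal and $j$-th vertical grid lines, so $\langle i,j\rangle$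 has corners $(i,j),(i,j+1),(i+1,j),(i+1,j+1)$. For $i,j\in[n+1]$, $\varphi_{(i,j)}(\pi)$ is the $\sigma\in\mathfrak{B}_{n+1}$ with $\sigma_i=j$, $\sigma_k=s(\pi_k)$ for $k<i$, $\sigma_k=s(\pi_{k-1})$ for $k>i$, where $s(x)=x$ if $|x|<j$, $s(x)=x+1$ if $x\ge j$, $s(x)=x-1$ if $x\le-j$; $\overline{\varphi}_{(i,j)}(\pi)$ is the same with $\sigma_i=-j$. $d^+(i,j)=\big(\operatorname{des}_B(\varphi_{(i,j)}(\pi))-\operatorname{des}_B(\pi),\ \operatorname{ides}_B(\varphi_{(i,j)}(\pi))-\operatorname{ides}_B(\pi)\big)$, and $d^-(i,j)$ is the same with $\overline{\varphi}_{(i,j)}$. -}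

module Defs where

open import Data.Bool using (Bool; true; false; if_then_else_)
open import Data.Nat as ℕ using (ℕ; zero; suc)
open import Data.Integer as ℤ using (ℤ; +_; -_; ∣_∣; _-_; _+_; _<?_; _≤?_)
open import Data.List using (List; []; _∷_; length; map; take; drop; _++_)
open import Data.List.Relation.Unary.All using (All)
open import Data.List.Relation.Unary.Unique.Propositional using (Unique)
open import Data.Product using (_×_; _,_)
open import Relation.Binary.PropositionalEquality using (_≡_)
open import Relation.Nullary.Decidable using (does)

-- A signed permutation π = π₁⋯πₙ is represented as the list [π₁, …, πₙ] of integers.
IsSignedPerm : ℕ → List ℤ → Set
IsSignedPerm n π =
  length π ≡ n × All (λ x → 1 ℕ.≤ ∣ x ∣ × ∣ x ∣ ℕ.≤ n) π × Unique (map ∣_∣ π)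

-- πᵢ for 1 ≤ i ≤ n (1-based); returns 0 out of range.
entry : List ℤ → ℕ → ℤ
entry []       _             = + 0
entry (x ∷ xs) zero          = + 0
entry (x ∷ xs) (suc zero)    = x
entry (x ∷ xs) (suc (suc i)) = entry xs (suc i)

-- the r-order: -1 <_r -2 <_r -3 <_r ⋯ <_r 0 <_r 1 <_r 2 <_r ⋯
-- gtʳ x y = true iff x >_r y
isNeg : ℤ → Bool
isNeg x = does (x <? + 0)

gtʳ : ℤ → ℤ → Bool
gtʳ x y with isNeg x | isNeg y
... | true  | true  = does (x <? y)
... | false | true  = true
... | true  | false = false
... | false | false = does (y <? x)

descents : List ℤ → ℕ
descents []           = 0
descents (x ∷ [])     = 0
descents (x ∷ y ∷ xs) = (if gtʳ x y then 1 else 0) ℕ.+ descents (y ∷ xs)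

desB : List ℤ → ℕ
desB π = descents (+ 0 ∷ π)

signed : ℤ → ℕ → ℤ
signed x i = if isNeg x then - (+ i) else + i

findInv : ℕ → List ℤ → ℕ → ℤ
findInv k []       i = + 0
findInv k (x ∷ xs) i = if does (∣ x ∣ ℕ.≟ k) then signed x i else findInv k xs (suc i)

upFrom : ℕ → ℕ → List ℕ
upFrom s zero    = []
upFrom s (suc m) = s ∷ upFrom (suc s) m

-- inverse: π⁻¹_{|πᵢ|} = sgn(πᵢ) i
inverse : List ℤ → List ℤ
inverse π = map (λ k → findInv k π 1) (upFrom 1 (length π))

idesB : List ℤ → ℕ
idesB π = desB (inverse π)

shift : ℕ → ℤ → ℤ
shift j x = if does (+ j ≤? x) then x + + 1
            else (if does (x ≤? - (+ j)) then x - + 1 else x)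

-- insert value v at (1-based) position i after shifting by j
insertAt : ℕ → ℤ → ℕ → List ℤ → List ℤ
insertAt i v j π = take (i ℕ.∸ 1) (map (shift j) π) ++ (v ∷ drop (i ℕ.∸ 1) (map (shift j) π))

φ : ℕ → ℕ → List ℤ → List ℤ
φ i j π = insertAt i (+ j) j π

φ̄ : ℕ → ℕ → List ℤ → List ℤ
φ̄ i j π = insertAt i (- (+ j)) j π

dPlus : List ℤ → ℕ → ℕ → ℤ × ℤ
dPlus π i j = (+ desB (φ i j π) - + desB π , + idesB (φ i j π) - + idesB π)

dMinus : List ℤ → ℕ → ℕ → ℤ × ℤ
dMinus π i j = (+ desB (φ̄ i j π) - + desB π , + idesB (φ̄ i j π) - + idesB π)

{-# OPTIONS --safe #-}
-- Let πᵢ = x, so |x| = j. In each of the four insertions the new entry and the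
-- shifted old entry are x and up x, which are consecutive in the r-order, and no
-- other shifted entry (nor π₀ = 0) lies between them. So every comparison with a
-- third entry is unchanged and des_B changes exactly by the comparison of the two
-- adjacent entries: by 0 if they stand in increasing r-order, by 1 otherwise.
-- For ides_B, insertion commutes with transposing the grid,
-- φ_{(i,j)}(π)⁻¹ = φ_{(j,i)}(π⁻¹) with the new entry signed like x, so the same count
-- applies to π⁻¹ at the square ⟨j,i⟩, with the north-east and south-west corners swapped.

module Submission where

open import Defs
open import Data.Nat using (ℕ; suc; _≤_)
open import Data.Integer using (ℤ; +_; -_)
open import Data.List using (List)
open import Data.Product using (_×_; _,_)
open import Relation.Binary.PropositionalEquality using (_≡_)

open import Data.Bool using (Bool; true; false; if_then_else_)
open import Data.Empty using (⊥-elim)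
open import Data.Integer using (-[1+_]; ∣_∣; _-_; +≤+; -≤-)
import Data.Integer.Properties as ℤ
open import Data.List using ([]; _∷_; length; map; take; drop; _++_)
import Data.List.Properties as List
open import Data.List.Relation.Unary.All using (All; _∷_)
open import Data.List.Relation.Unary.All.Properties using (map⁻)
open import Data.List.Relation.Unary.AllPairs using (_∷_)
open import Data.List.Relation.Unary.Unique.Propositional using (Unique)
open import Data.Product using (proj₁; proj₂)
open import Data.Nat using (zero; z≤n; s≤s; z<s; _<_; _+_; _∸_; _<ᵇ_; _≟_; _≤?_; _<?_)
import Data.Nat.Properties as ℕ
open import Algebra.Properties.CommutativeSemigroup ℕ.+-commutativeSemigroup using (x∙yz≈y∙xz)
open import Function using (_∘_)
open import Function.Definitions using (Injective)
open import Relation.Binary using (tri<; tri≈; tri>)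
open import Relation.Binary.PropositionalEquality
  using (_≢_; refl; sym; trans; cong; cong₂; subst; module ≡-Reasoning)
open import Relation.Nullary using (does; yes; no)
open import Relation.Nullary.Decidable using (dec-true; dec-false)

open ≡-Reasoning

⟦_⟧ : Bool → ℕ
⟦ b ⟧ = if b then 1 else 0

-- The successor in the r-order: m ↦ m + 1 and -m ↦ -(m + 1).
up : ℤ → ℤ
up (+ m)    = + suc m
up -[1+ m ] = -[1+ suc m ]

∣up∣ : ∀ x → ∣ up x ∣ ≡ suc ∣ x ∣
∣up∣ (+ m)    = refl
∣up∣ -[1+ m ] = refl

isNeg-up : ∀ x → isNeg (up x) ≡ isNeg x
isNeg-up (+ m)    = refl
isNeg-up -[1+ m ] = refl

up-injective : Injective _≡_ _≡_ up
up-injective {+ m}      {+ .m}      refl = refl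
up-injective { -[1+ m ]} { -[1+ .m ]} refl = refl

<ᵇ-sucʳ : ∀ {m n} → n ≢ m → (n <ᵇ suc m) ≡ (n <ᵇ m)
<ᵇ-sucʳ {zero}  {zero}  n≢m = ⊥-elim (n≢m refl)
<ᵇ-sucʳ {suc m} {zero}  _   = refl
<ᵇ-sucʳ {zero}  {suc n} _   = refl
<ᵇ-sucʳ {suc m} {suc n} n≢m = <ᵇ-sucʳ (n≢m ∘ cong suc)

<ᵇ-sucˡ : ∀ {m n} → n ≢ suc m → (suc m <ᵇ n) ≡ (m <ᵇ n)
<ᵇ-sucˡ {n = zero}  _   = refl
<ᵇ-sucˡ {n = suc n} n≢m = sym (<ᵇ-sucʳ (n≢m ∘ cong suc ∘ sym))

n<ᵇ1+n : ∀ n → (n <ᵇ suc n) ≡ true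
n<ᵇ1+n zero    = refl
n<ᵇ1+n (suc n) = n<ᵇ1+n n

1+n<ᵇn : ∀ n → (suc n <ᵇ n) ≡ false
1+n<ᵇn zero    = refl
1+n<ᵇn (suc n) = 1+n<ᵇn n

gtʳ-x-up[x] : ∀ x → gtʳ x (up x) ≡ false
gtʳ-x-up[x] (+ m)    = 1+n<ᵇn m
gtʳ-x-up[x] -[1+ m ] = 1+n<ᵇn m

gtʳ-up[x]-x : ∀ x → gtʳ (up x) x ≡ true
gtʳ-up[x]-x (+ m)    = n<ᵇ1+n m
gtʳ-up[x]-x -[1+ m ] = n<ᵇ1+n m

gtʳ-upˡ : ∀ x y → y ≢ x → gtʳ (up x) y ≡ gtʳ x y
gtʳ-upˡ (+ m)    (+ n)    y≢x = <ᵇ-sucʳ (y≢x ∘ cong (+_))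
gtʳ-upˡ (+ m)    -[1+ n ] _   = refl
gtʳ-upˡ -[1+ m ] (+ n)    _   = refl
gtʳ-upˡ -[1+ m ] -[1+ n ] y≢x = <ᵇ-sucʳ (y≢x ∘ cong -[1+_])

gtʳ-upʳ : ∀ x y → y ≢ up x → gtʳ y (up x) ≡ gtʳ y x
gtʳ-upʳ (+ m)    (+ n)    y≢x = <ᵇ-sucˡ (y≢x ∘ cong (+_))
gtʳ-upʳ (+ m)    -[1+ n ] _   = refl
gtʳ-upʳ -[1+ m ] (+ n)    _   = refl
gtʳ-upʳ -[1+ m ] -[1+ n ] y≢x = <ᵇ-sucˡ (y≢x ∘ cong -[1+_])

gtʳ-up-up : ∀ x y → gtʳ (up x) (up y) ≡ gtʳ x y
gtʳ-up-up (+ m)    (+ n)    = refl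
gtʳ-up-up (+ m)    -[1+ n ] = refl
gtʳ-up-up -[1+ m ] (+ n)    = refl
gtʳ-up-up -[1+ m ] -[1+ n ] = refl

record NotBetween (c u w : ℤ) : Set where
  constructor notBetween
  field
    lhs : gtʳ c u ≡ gtʳ c w
    rhs : gtʳ u c ≡ gtʳ w c

notBetween-up : ∀ {c} x → c ≢ x → c ≢ up x → NotBetween c (up x) x
notBetween-up x c≢x c≢up[x] = notBetween (gtʳ-upʳ x _ c≢up[x]) (gtʳ-upˡ x _ c≢x)

notBetween-sym : ∀ {c u w} → NotBetween c u w → NotBetween c w u
notBetween-sym (notBetween l r) = notBetween (sym l) (sym r)

shift-below : ∀ {J} x → ∣ x ∣ < J → shift J x ≡ x
shift-below {suc J} (+ m) m<J
  rewrite dec-false (+ suc J ℤ.≤? + m) (λ { (+≤+ J≤m) → ℕ.<⇒≱ m<J J≤m })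
        | dec-false (+ m ℤ.≤? -[1+ J ]) (λ ()) = refl
shift-below {suc J} -[1+ m ] m<J
  rewrite dec-false (+ suc J ℤ.≤? -[1+ m ]) (λ ())
        | dec-false (-[1+ m ] ℤ.≤? -[1+ J ]) (λ { (-≤- J≤m) → ℕ.<⇒≱ m<J (s≤s J≤m) }) = refl

shift-above : ∀ {J} x → J ≤ ∣ x ∣ → shift J x ≡ up x
shift-above {J} (+ m) J≤m
  rewrite dec-true (+ J ℤ.≤? + m) (+≤+ J≤m) = cong +_ (ℕ.+-comm m 1)
shift-above {zero} -[1+ m ] _ = cong (λ k → -[1+ suc k ]) (ℕ.+-identityʳ m)
shift-above {suc J} -[1+ m ] (s≤s J≤m)
  rewrite dec-false (+ suc J ℤ.≤? -[1+ m ]) (λ ())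
        | dec-true (-[1+ m ] ℤ.≤? -[1+ J ]) (-≤- J≤m) = cong (λ k → -[1+ suc k ]) (ℕ.+-identityʳ m)

data ShiftView (J : ℕ) (x : ℤ) : ℤ → Set where
  below : ∣ x ∣ < J → ShiftView J x x
  above : J ≤ ∣ x ∣ → ShiftView J x (up x)

shiftView : ∀ J x → ShiftView J x (shift J x)
shiftView J x with ∣ x ∣ <? J
... | yes x<J = subst (ShiftView J x) (sym (shift-below x x<J)) (below x<J)
... | no  x≮J = subst (ShiftView J x) (sym (shift-above x (ℕ.≮⇒≥ x≮J))) (above (ℕ.≮⇒≥ x≮J))

gtʳ-shift : ∀ J x y → gtʳ (shift J x) (shift J y) ≡ gtʳ x y
gtʳ-shift J x y with shift J x | shiftView J x | shift J y | shiftView J y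
... | _ | below _   | _ | below _   = refl
... | _ | above _   | _ | above _   = gtʳ-up-up x y
... | _ | above J≤x | _ | below y<J =
  gtʳ-upˡ x y (λ y≡x → ℕ.<⇒≱ y<J (subst (J ≤_) (cong ∣_∣ (sym y≡x)) J≤x))
... | _ | below x<J | _ | above J≤y =
  gtʳ-upʳ y x (λ x≡up[y] → ℕ.<⇒≱ x<J (ℕ.≤-trans (ℕ.m≤n⇒m≤1+n J≤y) (ℕ.≤-reflexive (sym (trans (cong ∣_∣ x≡up[y]) (∣up∣ y))))))

isNeg-shift : ∀ J x → isNeg (shift J x) ≡ isNeg x
isNeg-shift J x with shift J x | shiftView J x
... | _ | below _ = refl
... | _ | above _ = isNeg-up x

shift-injective : ∀ J → Injective _≡_ _≡_ (shift J)
shift-injective J {x} {y} eq with shift J x | shiftView J x | shift J y | shiftView J y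
... | _ | below _   | _ | below _   = eq
... | _ | above _   | _ | above _   = up-injective eq
... | _ | above J≤x | _ | below y<J =
  ⊥-elim (ℕ.<⇒≱ y<J (ℕ.≤-trans J≤x (ℕ.≤-trans (ℕ.n≤1+n _) (ℕ.≤-reflexive (trans (sym (∣up∣ x)) (cong ∣_∣ eq))))))
... | _ | below x<J | _ | above J≤y =
  ⊥-elim (ℕ.<⇒≱ x<J (ℕ.≤-trans J≤y (ℕ.≤-trans (ℕ.n≤1+n _) (ℕ.≤-reflexive (trans (sym (∣up∣ y)) (cong ∣_∣ (sym eq)))))))

shiftℕ : ℕ → ℕ → ℕ
shiftℕ J k = if does (J ≤? k) then suc k else k

shiftℕ-below : ∀ {J k} → k < J → shiftℕ J k ≡ k
shiftℕ-below {J} {k} k<J = cong (λ b → if b then suc k else k) (dec-false (J ≤? k) (ℕ.<⇒≱ k<J))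

shiftℕ-above : ∀ {J k} → J ≤ k → shiftℕ J k ≡ suc k
shiftℕ-above {J} {k} J≤k = cong (λ b → if b then suc k else k) (dec-true (J ≤? k) J≤k)

∣shift∣ : ∀ J x → ∣ shift J x ∣ ≡ shiftℕ J ∣ x ∣
∣shift∣ J x with shift J x | shiftView J x
... | _ | below x<J = sym (shiftℕ-below x<J)
... | _ | above J≤x = trans (∣up∣ x) (sym (shiftℕ-above J≤x))

shiftℕ-injective : ∀ J → Injective _≡_ _≡_ (shiftℕ J)
shiftℕ-injective J {k} {l} eq with J ≤? k | J ≤? l
... | yes J≤k | yes J≤l = ℕ.suc-injective (trans (sym (shiftℕ-above J≤k)) (trans eq (shiftℕ-above J≤l)))
... | no  J≰k | no  J≰l = trans (sym (shiftℕ-below (ℕ.≰⇒> J≰k))) (trans eq (shiftℕ-below (ℕ.≰⇒> J≰l)))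
... | yes J≤k | no  J≰l = ⊥-elim (J≰l (ℕ.≤-trans J≤k (ℕ.≤-trans (ℕ.n≤1+n k)
  (ℕ.≤-reflexive (trans (sym (shiftℕ-above J≤k)) (trans eq (shiftℕ-below (ℕ.≰⇒> J≰l))))))))
... | no  J≰k | yes J≤l = ⊥-elim (J≰k (ℕ.≤-trans J≤l (ℕ.≤-trans (ℕ.n≤1+n l)
  (ℕ.≤-reflexive (trans (sym (shiftℕ-above J≤l)) (trans (sym eq) (shiftℕ-below (ℕ.≰⇒> J≰k))))))))

shiftℕ≢ : ∀ J k → shiftℕ J k ≢ J
shiftℕ≢ J k with J ≤? k
... | yes J≤k = λ eq → ℕ.<⇒≱ (ℕ.≤-reflexive (trans (sym (shiftℕ-above J≤k)) eq)) J≤k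
... | no  J≰k = λ eq → J≰k (ℕ.≤-reflexive (trans (sym eq) (shiftℕ-below (ℕ.≰⇒> J≰k))))

∣shift∣≢ : ∀ J x → ∣ shift J x ∣ ≢ J
∣shift∣≢ J x = shiftℕ≢ J ∣ x ∣ ∘ trans (sym (∣shift∣ J x))

notBetween-lower : ∀ J x → ∣ x ∣ ≡ J → ∀ b → b ≢ x → NotBetween (shift J b) x (shift J x)
notBetween-lower J x ∣x∣≡J b b≢x = subst (NotBetween (shift J b) x) (sym shift[x]≡up[x]) (notBetween-sym
  (notBetween-up x (∣shift∣≢ J b ∘ λ e → trans (cong ∣_∣ e) ∣x∣≡J)
                   (b≢x ∘ shift-injective J ∘ λ e → trans e (sym shift[x]≡up[x]))))
  where shift[x]≡up[x] = shift-above x (ℕ.≤-reflexive (sym ∣x∣≡J))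

notBetween-upper : ∀ J x → suc ∣ x ∣ ≡ J → ∀ b → b ≢ x → NotBetween (shift J b) (up x) (shift J x)
notBetween-upper J x 1+∣x∣≡J b b≢x = subst (NotBetween (shift J b) (up x)) (sym shift[x]≡x)
  (notBetween-up x (b≢x ∘ shift-injective J ∘ λ e → trans e (sym shift[x]≡x))
                   (∣shift∣≢ J b ∘ λ e → trans (cong ∣_∣ e) (trans (∣up∣ x) 1+∣x∣≡J)))
  where shift[x]≡x = shift-below x (ℕ.≤-reflexive 1+∣x∣≡J)

-- Descents after an insertion

descents-map-shift : ∀ J L → descents (map (shift J) L) ≡ descents L
descents-map-shift J []          = refl
descents-map-shift J (x ∷ [])    = refl
descents-map-shift J (x ∷ y ∷ L) = cong₂ (λ b d → ⟦ b ⟧ + d) (gtʳ-shift J x y) (descents-map-shift J (y ∷ L))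

descents-shift-∷ : ∀ J p y L ρ k → descents (shift J y ∷ L) ≡ k + descents (y ∷ ρ) →
  descents (shift J p ∷ shift J y ∷ L) ≡ k + descents (p ∷ y ∷ ρ)
descents-shift-∷ J p y L ρ k eq = begin
  ⟦ gtʳ (shift J p) (shift J y) ⟧ + descents (shift J y ∷ L) ≡⟨ cong₂ (λ b d → ⟦ b ⟧ + d) (gtʳ-shift J p y) eq ⟩
  ⟦ gtʳ p y ⟧ + (k + descents (y ∷ ρ))                       ≡⟨ x∙yz≈y∙xz ⟦ gtʳ p y ⟧ k _ ⟩
  k + descents (p ∷ y ∷ ρ)                                   ∎

-- p plays the role of the entry preceding ρ; desB is the case p = + 0, which shift J fixes for J ≥ 1.
module Insertion {J : ℕ} {x v : ℤ} (x≢0 : x ≢ + 0)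
                 (apart : ∀ b → b ≢ x → NotBetween (shift J b) v (shift J x)) where

  before : ∀ p i ρ → entry ρ (suc i) ≡ x → entry (p ∷ ρ) (suc i) ≢ x →
    descents (shift J p ∷ insertAt (suc i) v J ρ) ≡ ⟦ gtʳ v (shift J x) ⟧ + descents (p ∷ ρ)
  before p zero    []      ρ₁≡x _   = ⊥-elim (x≢0 (sym ρ₁≡x))
  before p zero    (.x ∷ ρ) refl p≢x = begin
    ⟦ gtʳ (shift J p) v ⟧ + (⟦ gtʳ v (shift J x) ⟧ + descents (map (shift J) (x ∷ ρ)))
      ≡⟨ cong₂ (λ b d → ⟦ b ⟧ + (⟦ gtʳ v (shift J x) ⟧ + d))
               (trans (NotBetween.lhs (apart p p≢x)) (gtʳ-shift J p x)) (descents-map-shift J (x ∷ ρ)) ⟩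
    ⟦ gtʳ p x ⟧ + (⟦ gtʳ v (shift J x) ⟧ + descents (x ∷ ρ))
      ≡⟨ x∙yz≈y∙xz ⟦ gtʳ p x ⟧ ⟦ gtʳ v (shift J x) ⟧ (descents (x ∷ ρ)) ⟩
    ⟦ gtʳ v (shift J x) ⟧ + descents (p ∷ x ∷ ρ)
      ∎
  before p (suc i) []      ρᵢ≡x _   = ⊥-elim (x≢0 (sym ρᵢ≡x))
  before p (suc i) (y ∷ ρ) ρᵢ≡x ρᵢ₋₁≢x =
    descents-shift-∷ J p y (insertAt (suc i) v J ρ) ρ ⟦ gtʳ v (shift J x) ⟧ (before y i ρ ρᵢ≡x ρᵢ₋₁≢x)

  after : ∀ p i ρ → entry ρ (suc i) ≡ x → entry ρ (suc (suc i)) ≢ x →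
    descents (shift J p ∷ insertAt (suc (suc i)) v J ρ) ≡ ⟦ gtʳ (shift J x) v ⟧ + descents (p ∷ ρ)
  after p zero    []       ρ₁≡x _   = ⊥-elim (x≢0 (sym ρ₁≡x))
  after p zero    (.x ∷ ρ) refl ρ₂≢x =
    descents-shift-∷ J p x (v ∷ map (shift J) ρ) ρ ⟦ gtʳ (shift J x) v ⟧
      (cong (λ d → ⟦ gtʳ (shift J x) v ⟧ + d) (trans (head-swap ρ ρ₂≢x) (descents-map-shift J (x ∷ ρ))))
    where
      head-swap : ∀ ρ → entry (x ∷ ρ) 2 ≢ x →
        descents (v ∷ map (shift J) ρ) ≡ descents (shift J x ∷ map (shift J) ρ)
      head-swap []      _   = refl
      head-swap (b ∷ ρ) b≢x = cong (λ c → ⟦ c ⟧ + descents (map (shift J) (b ∷ ρ))) (NotBetween.rhs (apart b b≢x))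
  after p (suc i) []      ρᵢ≡x _   = ⊥-elim (x≢0 (sym ρᵢ≡x))
  after p (suc i) (y ∷ ρ) ρᵢ≡x ρᵢ₊₁≢x =
    descents-shift-∷ J p y (insertAt (suc (suc i)) v J ρ) ρ ⟦ gtʳ (shift J x) v ⟧ (after y i ρ ρᵢ≡x ρᵢ₊₁≢x)

neighbours-≢ : ∀ {x} ρ i → x ≢ + 0 → (∀ q → entry ρ (suc q) ≡ x → q ≡ i) →
  entry (+ 0 ∷ ρ) (suc i) ≢ x × entry ρ (suc (suc i)) ≢ x
neighbours-≢ ρ zero    x≢0 only = x≢0 ∘ sym , ℕ.1+n≢n ∘ only 1
neighbours-≢ ρ (suc i) x≢0 only = ℕ.1+n≢n ∘ sym ∘ only i , ℕ.1+n≢n ∘ only (suc (suc i))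

record CornerDescents (ρ : List ℤ) (i J : ℕ) (x : ℤ) : Set where
  field
    northwest : desB (insertAt i x J ρ) ≡ desB ρ
    southeast : desB (insertAt (suc i) (up x) (suc J) ρ) ≡ desB ρ
    northeast : desB (insertAt i (up x) (suc J) ρ) ≡ suc (desB ρ)
    southwest : desB (insertAt (suc i) x J ρ) ≡ suc (desB ρ)

nonzero : ∀ {x n} → ∣ x ∣ ≡ suc n → x ≢ + 0
nonzero ∣x∣≡1+n refl = ℕ.0≢1+n ∣x∣≡1+n

cornerDescents : ∀ ρ i j x → ∣ x ∣ ≡ suc j → entry ρ (suc i) ≡ x →
  (∀ q → entry ρ (suc q) ≡ x → q ≡ i) → CornerDescents ρ (suc i) (suc j) x
cornerDescents ρ i j x ∣x∣≡1+j ρᵢ≡x only = record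
  { northwest = settle (gtʳ x)              (Lower.before (+ 0) i ρ ρᵢ≡x ρᵢ₋₁≢x) shift-lower (gtʳ-x-up[x] x)
  ; southeast = settle (λ z → gtʳ z (up x)) (Upper.after (+ 0) i ρ ρᵢ≡x ρᵢ₊₁≢x)  shift-upper (gtʳ-x-up[x] x)
  ; northeast = settle (gtʳ (up x))         (Upper.before (+ 0) i ρ ρᵢ≡x ρᵢ₋₁≢x) shift-upper (gtʳ-up[x]-x x)
  ; southwest = settle (λ z → gtʳ z x)      (Lower.after (+ 0) i ρ ρᵢ≡x ρᵢ₊₁≢x)  shift-lower (gtʳ-up[x]-x x)
  }
  where
    settle : ∀ {d} (c : ℤ → Bool) {z w b} → d ≡ ⟦ c z ⟧ + desB ρ → z ≡ w → c w ≡ b → d ≡ ⟦ b ⟧ + desB ρ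
    settle c d≡ z≡w cw≡b = trans d≡ (cong (λ b → ⟦ b ⟧ + desB ρ) (trans (cong c z≡w) cw≡b))
    x≢0 = nonzero ∣x∣≡1+j
    ρᵢ₋₁≢x = proj₁ (neighbours-≢ ρ i x≢0 only)
    ρᵢ₊₁≢x = proj₂ (neighbours-≢ ρ i x≢0 only)
    shift-lower : shift (suc j) x ≡ up x
    shift-lower = shift-above x (ℕ.≤-reflexive (sym ∣x∣≡1+j))
    shift-upper : shift (suc (suc j)) x ≡ x
    shift-upper = shift-below x (s≤s (ℕ.≤-reflexive ∣x∣≡1+j))
    -- Lower inserts x just below the shifted old entry up x, Upper inserts up x just above x.
    module Lower = Insertion x≢0 (notBetween-lower (suc j) x ∣x∣≡1+j)
    module Upper = Insertion x≢0 (notBetween-upper (suc (suc j)) x (cong suc ∣x∣≡1+j))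

-- Positions of values and the inverse

∣signed∣ : ∀ x p → ∣ signed x p ∣ ≡ p
∣signed∣ x p with isNeg x
... | true  = ℤ.∣-i∣≡∣i∣ (+ p)
... | false = refl

signed-isNeg : ∀ x y p → isNeg x ≡ isNeg y → signed x p ≡ signed y p
signed-isNeg x y p = cong (λ b → if b then - (+ p) else + p)

signed-up : ∀ x p → signed (up x) p ≡ signed x p
signed-up x p = signed-isNeg (up x) x p (isNeg-up x)

up-signed : ∀ x p → up (signed x (suc p)) ≡ signed x (suc (suc p))
up-signed x p with isNeg x
... | true  = refl
... | false = refl

findInv-here : ∀ {k} y π o → ∣ y ∣ ≡ k → findInv k (y ∷ π) o ≡ signed y o
findInv-here {k} y π o ∣y∣≡k =
  cong (λ b → if b then signed y o else findInv k π (suc o)) (dec-true (∣ y ∣ ≟ k) ∣y∣≡k)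

findInv-there : ∀ {k} y π o → ∣ y ∣ ≢ k → findInv k (y ∷ π) o ≡ findInv k π (suc o)
findInv-there {k} y π o ∣y∣≢k =
  cong (λ b → if b then signed y o else findInv k π (suc o)) (dec-false (∣ y ∣ ≟ k) ∣y∣≢k)

findInv-offset : ∀ {J} k π o → 0 < J → J ≤ suc o → findInv k π (suc (suc o)) ≡ shift J (findInv k π (suc o))
findInv-offset k []      o 0<J _    = sym (shift-below (+ 0) 0<J)
findInv-offset {J} k (y ∷ π) o 0<J J≤o with ∣ y ∣ ≟ k
... | yes ∣y∣≡k = begin
  findInv k (y ∷ π) (suc (suc o))      ≡⟨ findInv-here y π (suc (suc o)) ∣y∣≡k ⟩
  signed y (suc (suc o))               ≡⟨ up-signed y o ⟨
  up (signed y (suc o))                ≡⟨ shift-above (signed y (suc o)) (subst (J ≤_) (sym (∣signed∣ y (suc o))) J≤o) ⟨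
  shift J (signed y (suc o))           ≡⟨ cong (shift J) (findInv-here y π (suc o) ∣y∣≡k) ⟨
  shift J (findInv k (y ∷ π) (suc o))  ∎
... | no ∣y∣≢k = begin
  findInv k (y ∷ π) (suc (suc o))      ≡⟨ findInv-there y π (suc (suc o)) ∣y∣≢k ⟩
  findInv k π (suc (suc (suc o)))      ≡⟨ findInv-offset k π (suc o) 0<J (ℕ.m≤n⇒m≤1+n J≤o) ⟩
  shift J (findInv k π (suc (suc o)))  ≡⟨ cong (shift J) (findInv-there y π (suc o) ∣y∣≢k) ⟨
  shift J (findInv k (y ∷ π) (suc o))  ∎

findInv-map : ∀ {f : ℤ → ℤ} {g : ℕ → ℕ} → (∀ y → ∣ f y ∣ ≡ g ∣ y ∣) → Injective _≡_ _≡_ g →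
  (∀ y → isNeg (f y) ≡ isNeg y) → ∀ k π o → findInv (g k) (map f π) o ≡ findInv k π o
findInv-map f-abs g-inj f-isNeg k []      o = refl
findInv-map {f} {g} f-abs g-inj f-isNeg k (y ∷ π) o with ∣ y ∣ ≟ k
... | yes ∣y∣≡k = begin
  findInv (g k) (f y ∷ map f π) o  ≡⟨ findInv-here (f y) (map f π) o (trans (f-abs y) (cong g ∣y∣≡k)) ⟩
  signed (f y) o                   ≡⟨ signed-isNeg (f y) y o (f-isNeg y) ⟩
  signed y o                       ≡⟨ findInv-here y π o ∣y∣≡k ⟨
  findInv k (y ∷ π) o              ∎
... | no ∣y∣≢k = begin
  findInv (g k) (f y ∷ map f π) o  ≡⟨ findInv-there (f y) (map f π) o (∣y∣≢k ∘ g-inj ∘ trans (sym (f-abs y))) ⟩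
  findInv (g k) (map f π) (suc o)  ≡⟨ findInv-map f-abs g-inj f-isNeg k π (suc o) ⟩
  findInv k π (suc o)              ≡⟨ findInv-there y π o ∣y∣≢k ⟨
  findInv k (y ∷ π) o              ∎

findInv-insertAt-≢ : ∀ {J v} k t π o → ∣ v ∣ ≡ J → t ≤ length π →
  findInv (shiftℕ J k) (insertAt (suc t) v J π) (suc o) ≡ shift (suc o + t) (findInv k π (suc o))
findInv-insertAt-≢ {J} {v} k zero π o ∣v∣≡J _ = begin
  findInv (shiftℕ J k) (v ∷ map (shift J) π) (suc o)  ≡⟨ findInv-there v (map (shift J) π) (suc o) (λ e → shiftℕ≢ J k (trans (sym e) ∣v∣≡J)) ⟩
  findInv (shiftℕ J k) (map (shift J) π) (suc (suc o)) ≡⟨ findInv-map (∣shift∣ J) (shiftℕ-injective J) (isNeg-shift J) k π (suc (suc o)) ⟩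
  findInv k π (suc (suc o))                            ≡⟨ findInv-offset k π o z<s ℕ.≤-refl ⟩
  shift (suc o) (findInv k π (suc o))                  ≡⟨ cong (λ m → shift m (findInv k π (suc o))) (ℕ.+-identityʳ (suc o)) ⟨
  shift (suc o + 0) (findInv k π (suc o))              ∎
findInv-insertAt-≢ {J} {v} k (suc t) (y ∷ π) o ∣v∣≡J (s≤s t≤n) with ∣ y ∣ ≟ k
... | yes ∣y∣≡k = begin
  findInv (shiftℕ J k) (shift J y ∷ insertAt (suc t) v J π) (suc o)
    ≡⟨ findInv-here (shift J y) (insertAt (suc t) v J π) (suc o) (trans (∣shift∣ J y) (cong (shiftℕ J) ∣y∣≡k)) ⟩
  signed (shift J y) (suc o)                          ≡⟨ signed-isNeg (shift J y) y (suc o) (isNeg-shift J y) ⟩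
  signed y (suc o)                                    ≡⟨ shift-below (signed y (suc o))
                                                           (subst (_< suc o + suc t) (sym (∣signed∣ y (suc o))) (ℕ.m<m+n (suc o) z<s)) ⟨
  shift (suc o + suc t) (signed y (suc o))            ≡⟨ cong (shift (suc o + suc t)) (findInv-here y π (suc o) ∣y∣≡k) ⟨
  shift (suc o + suc t) (findInv k (y ∷ π) (suc o))   ∎
... | no ∣y∣≢k = begin
  findInv (shiftℕ J k) (shift J y ∷ insertAt (suc t) v J π) (suc o)
    ≡⟨ findInv-there (shift J y) (insertAt (suc t) v J π) (suc o) (∣y∣≢k ∘ shiftℕ-injective J ∘ trans (sym (∣shift∣ J y))) ⟩
  findInv (shiftℕ J k) (insertAt (suc t) v J π) (suc (suc o)) ≡⟨ findInv-insertAt-≢ k t π (suc o) ∣v∣≡J t≤n ⟩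
  shift (suc (suc o) + t) (findInv k π (suc (suc o)))         ≡⟨ cong₂ shift (ℕ.+-suc (suc o) t) (findInv-there y π (suc o) ∣y∣≢k) ⟨
  shift (suc o + suc t) (findInv k (y ∷ π) (suc o))           ∎

findInv-insertAt-≡ : ∀ {J} v t π o → ∣ v ∣ ≡ J → t ≤ length π →
  findInv J (insertAt (suc t) v J π) (suc o) ≡ signed v (suc o + t)
findInv-insertAt-≡ {J} v zero π o ∣v∣≡J _ =
  trans (findInv-here v (map (shift J) π) (suc o) ∣v∣≡J) (cong (signed v) (sym (ℕ.+-identityʳ (suc o))))
findInv-insertAt-≡ {J} v (suc t) (y ∷ π) o ∣v∣≡J (s≤s t≤n) =
  trans (findInv-there (shift J y) (insertAt (suc t) v J π) (suc o) (∣shift∣≢ J y))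
        (trans (findInv-insertAt-≡ v t π (suc o) ∣v∣≡J t≤n) (cong (signed v) (sym (ℕ.+-suc (suc o) t))))

∣findInv∣ : ∀ k π o → findInv k π o ≢ + 0 → o ≤ ∣ findInv k π o ∣
∣findInv∣ k []      o nz = ⊥-elim (nz refl)
∣findInv∣ k (y ∷ π) o nz with ∣ y ∣ ≟ k
... | yes ∣y∣≡k = ℕ.≤-reflexive (sym (trans (cong ∣_∣ (findInv-here y π o ∣y∣≡k)) (∣signed∣ y o)))
... | no  ∣y∣≢k = subst (o ≤_) (cong ∣_∣ (sym (findInv-there y π o ∣y∣≢k)))
  (ℕ.<⇒≤ (∣findInv∣ k π (suc o) (nz ∘ trans (findInv-there y π o ∣y∣≢k))))

findInv-suc≢signed : ∀ k π o y → findInv k π (suc o) ≢ + 0 → findInv k π (suc o) ≢ signed y o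
findInv-suc≢signed k π o y nz eq =
  ℕ.1+n≰n (subst (suc o ≤_) (trans (cong ∣_∣ eq) (∣signed∣ y o)) (∣findInv∣ k π (suc o) nz))

findInv-injective : ∀ {k l} π o → findInv k π o ≡ findInv l π o → findInv k π o ≢ + 0 → k ≡ l
findInv-injective []      o _  nz = ⊥-elim (nz refl)
findInv-injective {k} {l} (y ∷ π) o eq nz with ∣ y ∣ ≟ k | ∣ y ∣ ≟ l
... | yes ∣y∣≡k | yes ∣y∣≡l = trans (sym ∣y∣≡k) ∣y∣≡l
... | yes ∣y∣≡k | no  ∣y∣≢l =
  ⊥-elim (findInv-suc≢signed l π o y (nz ∘ trans (findInv-here y π o ∣y∣≡k) ∘ trans found) (sym found))
  where found = trans (sym (findInv-here y π o ∣y∣≡k)) (trans eq (findInv-there y π o ∣y∣≢l))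
... | no  ∣y∣≢k | yes ∣y∣≡l =
  ⊥-elim (findInv-suc≢signed k π o y (nz ∘ trans (findInv-there y π o ∣y∣≢k)) found)
  where found = trans (sym (findInv-there y π o ∣y∣≢k)) (trans eq (findInv-here y π o ∣y∣≡l))
... | no  ∣y∣≢k | no  ∣y∣≢l = findInv-injective π (suc o)
  (trans (sym (findInv-there y π o ∣y∣≢k)) (trans eq (findInv-there y π o ∣y∣≢l))) (nz ∘ trans (findInv-there y π o ∣y∣≢k))

entry-All : ∀ {P : ℤ → Set} π p → All P π → entry π (suc p) ≢ + 0 → P (entry π (suc p))
entry-All []      p       _        nz = ⊥-elim (nz refl)
entry-All (y ∷ π) zero    (Py ∷ _) _  = Py
entry-All (y ∷ π) (suc p) (_ ∷ Pπ) nz = entry-All π p Pπ nz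

entry-unique : ∀ {x} π p q → Unique (map ∣_∣ π) → x ≢ + 0 → entry π (suc p) ≡ x → entry π (suc q) ≡ x → p ≡ q
entry-unique []      p       q       _       x≢0 πₚ≡x _    = ⊥-elim (x≢0 (sym πₚ≡x))
entry-unique (y ∷ π) zero    zero    _       _   _    _    = refl
entry-unique (y ∷ π) zero    (suc q) (y∉ ∷ _) x≢0 refl π_q≡y =
  ⊥-elim (entry-All π q (map⁻ y∉) (x≢0 ∘ trans (sym π_q≡y)) (cong ∣_∣ (sym π_q≡y)))
entry-unique (y ∷ π) (suc p) zero    (y∉ ∷ _) x≢0 πₚ≡y refl =
  ⊥-elim (entry-All π p (map⁻ y∉) (x≢0 ∘ trans (sym πₚ≡y)) (cong ∣_∣ (sym πₚ≡y)))
entry-unique (y ∷ π) (suc p) (suc q) (_ ∷ u) x≢0 πₚ≡x π_q≡x = cong suc (entry-unique π p q u x≢0 πₚ≡x π_q≡x)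

findInv-entry : ∀ {x} π p o → Unique (map ∣_∣ π) → x ≢ + 0 → entry π (suc p) ≡ x →
  findInv ∣ x ∣ π (suc o) ≡ signed x (suc o + p)
findInv-entry []      p       o _        x≢0 πₚ≡x = ⊥-elim (x≢0 (sym πₚ≡x))
findInv-entry (y ∷ π) zero    o _        _   refl =
  trans (findInv-here y π (suc o) refl) (cong (signed y) (sym (ℕ.+-identityʳ (suc o))))
findInv-entry (y ∷ π) (suc p) o (y∉ ∷ u) x≢0 refl =
  trans (findInv-there y π (suc o) (entry-All π p (map⁻ y∉) x≢0))
        (trans (findInv-entry π p (suc o) u x≢0 refl) (cong (signed (entry π (suc p))) (sym (ℕ.+-suc (suc o) p))))

entry-beyond : ∀ L k → length L ≤ k → entry L (suc k) ≡ + 0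
entry-beyond []      k       _          = refl
entry-beyond (x ∷ L) (suc k) (s≤s L≤k) = entry-beyond L k L≤k

entry-map : ∀ f L k → k < length L → entry (map f L) (suc k) ≡ f (entry L (suc k))
entry-map f (x ∷ L) zero    _         = refl
entry-map f (x ∷ L) (suc k) (s≤s k<n) = entry-map f L k k<n

entry-map-upFrom : ∀ (f : ℕ → ℤ) s m k → k < m → entry (map f (upFrom s m)) (suc k) ≡ f (s + k)
entry-map-upFrom f s (suc m) zero    _         = cong f (sym (ℕ.+-identityʳ s))
entry-map-upFrom f s (suc m) (suc k) (s≤s k<m) = trans (entry-map-upFrom f (suc s) m k k<m) (cong f (sym (ℕ.+-suc s k)))

entry-ext : ∀ L L′ → length L ≡ length L′ → (∀ k → k < length L → entry L (suc k) ≡ entry L′ (suc k)) → L ≡ L′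
entry-ext []      []       _  _    = refl
entry-ext (x ∷ L) (y ∷ L′) eq same =
  cong₂ _∷_ (same 0 z<s) (entry-ext L L′ (ℕ.suc-injective eq) (λ k k<n → same (suc k) (s≤s k<n)))

length-upFrom : ∀ s m → length (upFrom s m) ≡ m
length-upFrom s zero    = refl
length-upFrom s (suc m) = cong suc (length-upFrom (suc s) m)

length-insertAt : ∀ t w J L → length (insertAt t w J L) ≡ suc (length L)
length-insertAt t w J L = begin
  length (take (t ∸ 1) M ++ w ∷ drop (t ∸ 1) M) ≡⟨ List.length-++-sucʳ (take (t ∸ 1) M) w (drop (t ∸ 1) M) ⟩
  suc (length (take (t ∸ 1) M ++ drop (t ∸ 1) M)) ≡⟨ cong (suc ∘ length) (List.take++drop≡id (t ∸ 1) M) ⟩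
  suc (length M)                                  ≡⟨ cong suc (List.length-map (shift J) L) ⟩
  suc (length L)                                  ∎
  where M = map (shift J) L

entry-insertAt-< : ∀ {w J} t k L → k < t → t ≤ length L →
  entry (insertAt (suc t) w J L) (suc k) ≡ shift J (entry L (suc k))
entry-insertAt-< (suc t) zero    (y ∷ L) _         _         = refl
entry-insertAt-< (suc t) (suc k) (y ∷ L) (s≤s k<t) (s≤s t≤n) = entry-insertAt-< t k L k<t t≤n

entry-insertAt-≡ : ∀ {w J} t L → t ≤ length L → entry (insertAt (suc t) w J L) (suc t) ≡ w
entry-insertAt-≡ zero    L       _         = refl
entry-insertAt-≡ (suc t) (y ∷ L) (s≤s t≤n) = entry-insertAt-≡ t L t≤n

entry-insertAt-> : ∀ {w J} t k L → t ≤ k → k < length L →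
  entry (insertAt (suc t) w J L) (suc (suc k)) ≡ shift J (entry L (suc k))
entry-insertAt-> {J = J} zero k L _ k<n = entry-map (shift J) L k k<n
entry-insertAt-> (suc t) (suc k) (y ∷ L) (s≤s t≤k) (s≤s k<n) = entry-insertAt-> t k L t≤k k<n

length-inverse : ∀ π → length (inverse π) ≡ length π
length-inverse π = trans (List.length-map _ (upFrom 1 (length π))) (length-upFrom 1 (length π))

entry-inverse : ∀ π k → k < length π → entry (inverse π) (suc k) ≡ findInv (suc k) π 1
entry-inverse π = entry-map-upFrom (λ k → findInv k π 1) 1 (length π)

inverse-support : ∀ π k → entry (inverse π) (suc k) ≢ + 0 → k < length π
inverse-support π k nz with k <? length π
... | yes k<n = k<n
... | no  k≮n = ⊥-elim (nz (entry-beyond (inverse π) k (subst (_≤ k) (sym (length-inverse π)) (ℕ.≮⇒≥ k≮n))))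

inverse-entry-unique : ∀ {y} π p q → y ≢ + 0 →
  entry (inverse π) (suc p) ≡ y → entry (inverse π) (suc q) ≡ y → p ≡ q
inverse-entry-unique π p q y≢0 π⁻¹ₚ≡y π⁻¹_q≡y = ℕ.suc-injective (findInv-injective π 1
  (trans (sym (entry-inverse π p p<n)) (trans π⁻¹ₚ≡y (trans (sym π⁻¹_q≡y) (entry-inverse π q q<n))))
  (y≢0 ∘ trans (sym π⁻¹ₚ≡y) ∘ trans (entry-inverse π p p<n)))
  where
    p<n = inverse-support π p (y≢0 ∘ trans (sym π⁻¹ₚ≡y))
    q<n = inverse-support π q (y≢0 ∘ trans (sym π⁻¹_q≡y))

inverse-insertAt : ∀ π t J v → ∣ v ∣ ≡ suc J → t ≤ length π → J ≤ length π →
  inverse (insertAt (suc t) v (suc J) π) ≡ insertAt (suc J) (signed v (suc t)) (suc t) (inverse π)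
inverse-insertAt π t J v ∣v∣≡1+J t≤n J≤n = entry-ext (inverse π⁺) σ lengths entries
  where
    π⁺ = insertAt (suc t) v (suc J) π
    σ  = insertAt (suc J) (signed v (suc t)) (suc t) (inverse π)
    |π⁻¹|≡n = length-inverse π
    lengths : length (inverse π⁺) ≡ length σ
    lengths = begin
      length (inverse π⁺)    ≡⟨ trans (length-inverse π⁺) (length-insertAt (suc t) v (suc J) π) ⟩
      suc (length π)         ≡⟨ trans (length-insertAt (suc J) _ (suc t) (inverse π)) (cong suc |π⁻¹|≡n) ⟨
      length σ               ∎
    columns : ∀ k → k < suc (length π) → findInv (suc k) π⁺ 1 ≡ entry σ (suc k)
    columns k k≤n with ℕ.<-cmp k J
    ... | tri< k<J _ _ = begin
      findInv (suc k) π⁺ 1                       ≡⟨ cong (λ m → findInv m π⁺ 1) (shiftℕ-below (s≤s k<J)) ⟨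
      findInv (shiftℕ (suc J) (suc k)) π⁺ 1      ≡⟨ findInv-insertAt-≢ (suc k) t π 0 ∣v∣≡1+J t≤n ⟩
      shift (suc t) (findInv (suc k) π 1)        ≡⟨ cong (shift (suc t)) (entry-inverse π k (ℕ.<-≤-trans k<J J≤n)) ⟨
      shift (suc t) (entry (inverse π) (suc k))  ≡⟨ entry-insertAt-< J k (inverse π) k<J (subst (J ≤_) (sym |π⁻¹|≡n) J≤n) ⟨
      entry σ (suc k)                            ∎
    ... | tri≈ _ refl _ = begin
      findInv (suc J) π⁺ 1                       ≡⟨ findInv-insertAt-≡ v t π 0 ∣v∣≡1+J t≤n ⟩
      signed v (suc t)                           ≡⟨ entry-insertAt-≡ J (inverse π) (subst (J ≤_) (sym |π⁻¹|≡n) J≤n) ⟨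
      entry σ (suc J)                            ∎
    ... | tri> _ _ (s≤s {n = k′} J≤k′) = begin
      findInv (suc (suc k′)) π⁺ 1                ≡⟨ cong (λ m → findInv m π⁺ 1) (shiftℕ-above (s≤s J≤k′)) ⟨
      findInv (shiftℕ (suc J) (suc k′)) π⁺ 1     ≡⟨ findInv-insertAt-≢ (suc k′) t π 0 ∣v∣≡1+J t≤n ⟩
      shift (suc t) (findInv (suc k′) π 1)       ≡⟨ cong (shift (suc t)) (entry-inverse π k′ k′<n) ⟨
      shift (suc t) (entry (inverse π) (suc k′)) ≡⟨ entry-insertAt-> J k′ (inverse π) J≤k′ (subst (k′ <_) (sym |π⁻¹|≡n) k′<n) ⟨
      entry σ (suc (suc k′))                     ∎
      where k′<n = ℕ.≤-pred k≤n
    entries : ∀ k → k < length (inverse π⁺) → entry (inverse π⁺) (suc k) ≡ entry σ (suc k)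
    entries k k<n⁺ = trans (entry-inverse π⁺ k k<|π⁺|) (columns k (subst (k <_) (length-insertAt (suc t) v (suc J) π) k<|π⁺|))
      where k<|π⁺| = subst (k <_) (length-inverse π⁺) k<n⁺

-- d-types at the corners of a square

dType : List ℤ → ℕ → ℕ → ℤ → ℤ × ℤ
dType π i j v = (+ desB (insertAt i v j π) - + desB π , + idesB (insertAt i v j π) - + idesB π)

m≡n⇒+m-+n≡0 : ∀ {m n} → m ≡ n → + m - + n ≡ + 0
m≡n⇒+m-+n≡0 {m} refl = ℤ.+-inverseʳ (+ m)

m≡1+n⇒+m-+n≡1 : ∀ {m n} → m ≡ suc n → + m - + n ≡ + 1
m≡1+n⇒+m-+n≡1 {n = n} refl =
  trans (ℤ.[+m]-[+n]≡m⊖n (suc n) n) (trans (ℤ.⊖-≥ (ℕ.n≤1+n n)) (cong +_ (ℕ.m+n∸n≡m 1 n)))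

dType≡0 : ∀ π i j v → desB (insertAt i v j π) ≡ desB π → idesB (insertAt i v j π) ≡ idesB π →
  dType π i j v ≡ (+ 0 , + 0)
dType≡0 π i j v des≡ ides≡ = cong₂ _,_ (m≡n⇒+m-+n≡0 des≡) (m≡n⇒+m-+n≡0 ides≡)

dType≡1 : ∀ π i j v → desB (insertAt i v j π) ≡ suc (desB π) → idesB (insertAt i v j π) ≡ suc (idesB π) →
  dType π i j v ≡ (+ 1 , + 1)
dType≡1 π i j v des≡ ides≡ = cong₂ _,_ (m≡1+n⇒+m-+n≡1 des≡) (m≡1+n⇒+m-+n≡1 ides≡)

cornerDTypes : ∀ π i j x → Unique (map ∣_∣ π) → i < length π → j < length π → ∣ x ∣ ≡ suc j →
  entry π (suc i) ≡ x →
  dType π (suc i) (suc j) x ≡ (+ 0 , + 0) × dType π (suc (suc i)) (suc (suc j)) (up x) ≡ (+ 0 , + 0) ×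
  dType π (suc i) (suc (suc j)) (up x) ≡ (+ 1 , + 1) × dType π (suc (suc i)) (suc j) x ≡ (+ 1 , + 1)
cornerDTypes π i j x unique i<n j<n ∣x∣≡1+j πᵢ≡x =
    dType≡0 π (suc i) (suc j) x Des.northwest (trans (ides ∣x∣≡1+j i≤n j≤n refl) Ides.northwest)
  , dType≡0 π (suc (suc i)) (suc (suc j)) (up x) Des.southeast
      (trans (ides ∣up[x]∣≡2+j i<n j<n (trans (signed-up x _) (sym (up-signed x i)))) Ides.southeast)
  , dType≡1 π (suc i) (suc (suc j)) (up x) Des.northeast
      (trans (ides ∣up[x]∣≡2+j i≤n j<n (signed-up x (suc i))) Ides.southwest)
  , dType≡1 π (suc (suc i)) (suc j) x Des.southwest (trans (ides ∣x∣≡1+j i<n j≤n (sym (up-signed x i))) Ides.northeast)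
  where
    ρ = inverse π
    y = signed x (suc i)
    i≤n = ℕ.<⇒≤ i<n
    j≤n = ℕ.<⇒≤ j<n
    ∣up[x]∣≡2+j = trans (∣up∣ x) (cong suc ∣x∣≡1+j)
    ides : ∀ {t J v w} → ∣ v ∣ ≡ suc J → t ≤ length π → J ≤ length π → signed v (suc t) ≡ w →
      idesB (insertAt (suc t) v (suc J) π) ≡ desB (insertAt (suc J) w (suc t) ρ)
    ides {t} {J} {v} ∣v∣≡1+J t≤n J≤n refl = cong desB (inverse-insertAt π t J v ∣v∣≡1+J t≤n J≤n)
    ρⱼ≡y : entry ρ (suc j) ≡ y
    ρⱼ≡y = trans (entry-inverse π j j<n)
      (subst (λ k → findInv k π 1 ≡ y) ∣x∣≡1+j (findInv-entry π i 0 unique (nonzero ∣x∣≡1+j) πᵢ≡x))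
    module Des = CornerDescents (cornerDescents π i j x ∣x∣≡1+j πᵢ≡x
      (λ q π_q≡x → entry-unique π q i unique (nonzero ∣x∣≡1+j) π_q≡x πᵢ≡x))
    module Ides = CornerDescents (cornerDescents ρ j i y (∣signed∣ x (suc i)) ρⱼ≡y
      (λ q ρ_q≡y → inverse-entry-unique π q j (nonzero (∣signed∣ x (suc i))) ρ_q≡y ρⱼ≡y))

proposition6p4 : (n : ℕ) (π : List ℤ) → IsSignedPerm n π →
    (i j : ℕ) → 1 ≤ i → i ≤ n → 1 ≤ j → j ≤ n →
    (entry π i ≡ + j →
      dPlus π i j ≡ (+ 0 , + 0) × dPlus π (suc i) (suc j) ≡ (+ 0 , + 0) ×
      dPlus π i (suc j) ≡ (+ 1 , + 1) × dPlus π (suc i) j ≡ (+ 1 , + 1)) ×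
    (entry π i ≡ - (+ j) →
      dMinus π i j ≡ (+ 0 , + 0) × dMinus π (suc i) (suc j) ≡ (+ 0 , + 0) ×
      dMinus π i (suc j) ≡ (+ 1 , + 1) × dMinus π (suc i) j ≡ (+ 1 , + 1))
proposition6p4 .(length π) π (refl , _ , unique) (suc i) (suc j) (s≤s z≤n) i<n (s≤s z≤n) j<n =
    cornerDTypes π i j (+ suc j) unique i<n j<n refl
  , cornerDTypes π i j -[1+ j ] unique i<n j<n refl
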